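{- Let $\Sigma$ and $\Omega$ be finite sets. For all regular expressions $e,f$ over the alphabet $\Sigma+T_{\mathrm{BA}}$, we have $G(e)=G(f)$ if and only if $\mathcal{H}_{\mathrm{kat}}^\star(\llbracket e\rrbracket)=\mathcal{H}_{\mathrm{kat}}^\star(\llbracket f\rrbracket)$.
   Context: Regular expressions over an alphabet $X$: $e,f::=e+f\mid e\cdot f\mid e^*\mid 0\mid 1\mid a$ ($a\in X$), with usual language $\llbracket e\rrbracket\subseteq X^*$. A hypothesis is a pair of regular expressions written $e\le f$; an equation used as a hypothesis stands for two inequations. For a set $H$ of hypotheses, the $H$-closure $H^\star(L)$ of $L\subseteq X^*$ is the smallest language containing $L$ such that for all $e\le f\in H$ and words $u,v$, if $u\llbracket f\rrbracket v\subseteq H^\star(L)$ then $u\llbracket e\rrbracket v\subseteq H^\star(L)$. $T_{\mathrm{BA}}$ is the set of Boolean expressions $\phi::=\phi\vee\phi\mid\phi\wedge\phi\mid\neg\phi\mid\bot\mid\top\mid o$ ($o\in\Omega$), each being a single letter of $\Sigma+T_{\mathrm{BA}}$. $\mathcal{H}_{\mathrm{kat}}=\mathcal{H}_{\mathrm{bool}}\cup\mathcal{H}_{\mathrm{glue}}$ where $\mathcal{H}_{\mathrm{bool}}$ is the set of all instances $\phi=\psi$ of Boolean algebra axioms over $T_{\mathrm{BA}}$ and $\mathcal{H}_{\mathrm{glue}}=\{\phi\wedge\psi=\phi\cdot\psi,\ \phi\vee\psi=\phi+\psi\mid\phi,\psi\in T_{\mathrm{BA}}\}\cup\{\bot=0,\top=1\}$.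 Atoms are elements of $\mathsf{At}=2^\Omega$ (valuations of $\Omega$), each viewed as the Boolean expression $\bigwedge_{\alpha(o)=1}o\wedge\bigwedge_{\alpha(o)=0}\neg o$; $\alpha\models\phi$ means $\phi$ holds under $\alpha$. A guarded string is a word $\alpha_0a_0\alpha_1a_1\cdots a_{n-1}\alpha_n$ with $a_i\in\Sigma$, $\alpha_i\in\mathsf{At}$. The coalesced product of guarded strings $u\alpha$ and $\beta v$ is $u\alpha v$ if $\alpha=\beta$ and undefined otherwise, extended to sets $L\diamond K$ of guarded strings. $G$ maps regular expressions over $\Sigma+T_{\mathrm{BA}}$ to sets of guarded strings: $G(a)=\{\alpha a\beta\mid\alpha,\beta\in\mathsf{At}\}$ for $a\in\Sigma$, $G(\phi)=\{\alpha\mid\alpha\models\phi\}$ for $\phi\in T_{\mathrm{BA}}$, $G(0)=\emptyset$, $G(1)=\mathsf{At}$, $G(e+f)=G(e)\cup G(f)$, $G(e\cdot f)=G(e)\diamond G(f)$, $G(e^*)=\bigcup_{n}G(e)^{\diamond n}$ with $G(e)^{\diamond 0}=\mathsf{At}$ and $G(e)^{\diamond n+1}=G(e)\diamond G(e)^{\diamond n}$. -}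

module Defs where

open import Data.Nat using (ℕ; zero; suc)
open import Data.Fin using (Fin)
open import Data.Bool as B using (Bool; true; false)
open import Data.Vec using (Vec; lookup)
open import Data.List using (List; []; _∷_; _++_; [_])
open import Data.Sum using (_⊎_; inj₁; inj₂)
open import Data.Product using (Σ; _×_; _,_; ∃)
open import Data.Empty using (⊥)
open import Relation.Binary.PropositionalEquality using (_≡_)

infixl 6 _+_
infixl 7 _·_

data RE (X : Set) : Set where
  _+_ : RE X → RE X → RE X
  _·_ : RE X → RE X → RE X
  _⋆  : RE X → RE X
  𝟘   : RE X
  𝟙   : RE X
  `_  : X → RE X

Lang : Set → Set₁
Lang A = A → Set

powL : {X : Set} → ℕ → Lang (List X) → Lang (List X)
powL zero    L w = w ≡ []
powL {X} (suc n) L w = Σ (List X) λ u → Σ (List _) λ v → w ≡ u ++ v × L u × powL n L v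

⟦_⟧ : {X : Set} → RE X → Lang (List X)
⟦ e + f ⟧ w = ⟦ e ⟧ w ⊎ ⟦ f ⟧ w
⟦_⟧ {X} (e · f) w = Σ (List X) λ u → Σ (List X) λ v → w ≡ u ++ v × ⟦ e ⟧ u × ⟦ f ⟧ v
⟦ e ⋆ ⟧ w = Σ ℕ λ n → powL n ⟦ e ⟧ w
⟦ 𝟘 ⟧ w = ⊥
⟦ 𝟙 ⟧ w = w ≡ []
⟦ ` a ⟧ w = w ≡ [ a ]

_≐_ : {A : Set} → Lang A → Lang A → Set
L ≐ K = (∀ w → L w → K w) × (∀ w → K w → L w)

-- H-closure: the least language containing L and closed under
--   u ⟦f⟧ v ⊆ H⋆(L)  ⇒  u ⟦e⟧ v ⊆ H⋆(L)   for every hypothesis e ≤ f ∈ H.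
-- A set of hypotheses is a predicate H e f meaning (e ≤ f) ∈ H.

data Clo {X : Set} (H : RE X → RE X → Set) (L : Lang (List X)) : List X → Set where
  base : ∀ {w} → L w → Clo H L w
  hyp  : ∀ {e f} → H e f → (u v : List X) →
         (∀ w → ⟦ f ⟧ w → Clo H L (u ++ w ++ v)) →
         ∀ {x} w → ⟦ e ⟧ w → x ≡ u ++ w ++ v → Clo H L x

infixr 5 _⋁_
infixr 6 _⋀_

data BExp (k : ℕ) : Set where
  _⋁_ : BExp k → BExp k → BExp k
  _⋀_ : BExp k → BExp k → BExp k
  !_  : BExp k → BExp k
  bot : BExp k
  top : BExp k
  var : Fin k → BExp k

-- Atoms: valuations Ω → 2, represented as Boolean vectors
At : ℕ → Set
At k = Vec Bool k

eval : ∀ {k} → BExp k → At k → Bool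
eval (φ ⋁ ψ) α = eval φ α B.∨ eval ψ α
eval (φ ⋀ ψ) α = eval φ α B.∧ eval ψ α
eval (! φ)   α = B.not (eval φ α)
eval bot     α = false
eval top     α = true
eval (var o) α = lookup α o

_⊨_ : ∀ {k} → At k → BExp k → Set
α ⊨ φ = eval φ α ≡ true

-- Instances of (a standard axiomatisation of) Boolean algebra, each read as φ = ψ
data BAax {k : ℕ} : BExp k → BExp k → Set where
  ∨-assoc  : ∀ φ ψ χ → BAax ((φ ⋁ ψ) ⋁ χ) (φ ⋁ (ψ ⋁ χ))
  ∧-assoc  : ∀ φ ψ χ → BAax ((φ ⋀ ψ) ⋀ χ) (φ ⋀ (ψ ⋀ χ))
  ∨-comm   : ∀ φ ψ → BAax (φ ⋁ ψ) (ψ ⋁ φ)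
  ∧-comm   : ∀ φ ψ → BAax (φ ⋀ ψ) (ψ ⋀ φ)
  ∨-absorb : ∀ φ ψ → BAax (φ ⋁ (φ ⋀ ψ)) φ
  ∧-absorb : ∀ φ ψ → BAax (φ ⋀ (φ ⋁ ψ)) φ
  ∨-idem   : ∀ φ → BAax (φ ⋁ φ) φ
  ∧-idem   : ∀ φ → BAax (φ ⋀ φ) φ
  ∧-distr  : ∀ φ ψ χ → BAax (φ ⋀ (ψ ⋁ χ)) ((φ ⋀ ψ) ⋁ (φ ⋀ χ))
  ∨-distr  : ∀ φ ψ χ → BAax (φ ⋁ (ψ ⋀ χ)) ((φ ⋁ ψ) ⋀ (φ ⋁ χ))
  ∨-bot    : ∀ φ → BAax (φ ⋁ bot) φ
  ∧-top    : ∀ φ → BAax (φ ⋀ top) φ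
  ∨-compl  : ∀ φ → BAax (φ ⋁ ! φ) top
  ∧-compl  : ∀ φ → BAax (φ ⋀ ! φ) bot

-- The alphabet Σ + T_BA with Σ = Fin s, Ω = Fin k

Letter : ℕ → ℕ → Set
Letter s k = Fin s ⊎ BExp k

t : ∀ {s k} → BExp k → RE (Letter s k)
t φ = ` inj₂ φ

-- H_kat = H_bool ∪ H_glue; each equation contributes two inequations
data Hkat {s k : ℕ} : RE (Letter s k) → RE (Letter s k) → Set where
  bool≤ : ∀ {φ ψ} → BAax φ ψ → Hkat (t φ) (t ψ)
  bool≥ : ∀ {φ ψ} → BAax φ ψ → Hkat (t ψ) (t φ)
  ∧·≤   : ∀ φ ψ → Hkat (t (φ ⋀ ψ)) (t φ · t ψ)
  ∧·≥   : ∀ φ ψ → Hkat (t φ · t ψ) (t (φ ⋀ ψ))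
  ∨+≤   : ∀ φ ψ → Hkat (t (φ ⋁ ψ)) (t φ + t ψ)
  ∨+≥   : ∀ φ ψ → Hkat (t φ + t ψ) (t (φ ⋁ ψ))
  bot≤  : Hkat (t bot) 𝟘
  bot≥  : Hkat 𝟘 (t bot)
  top≤  : Hkat (t top) 𝟙
  top≥  : Hkat 𝟙 (t top)

-- Guarded strings α₀ a₀ α₁ … a_{n-1} α_n, as a first atom followed by
-- the list of pairs (aᵢ, αᵢ₊₁)

record GS (s k : ℕ) : Set where
  constructor gs
  field
    first : At k
    rest  : List (Fin s × At k)
open GS public

lastAt : ∀ {s k} → At k → List (Fin s × At k) → At k
lastAt α []             = α
lastAt α ((a , β) ∷ xs) = lastAt β xs

last : ∀ {s k} → GS s k → At k
last x = lastAt (first x) (rest x)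

_⋄_ : ∀ {s k} → Lang (GS s k) → Lang (GS s k) → Lang (GS s k)
_⋄_ {s} {k} L K w =
  Σ (GS s k) λ x → Σ (GS s k) λ y →
    L x × K y × last x ≡ first y × w ≡ gs (first x) (rest x ++ rest y)

atoms : ∀ {s k} → Lang (GS s k)
atoms w = rest w ≡ []

pow⋄ : ∀ {s k} → ℕ → Lang (GS s k) → Lang (GS s k)
pow⋄ zero    L = atoms
pow⋄ (suc n) L = L ⋄ pow⋄ n L

G : ∀ {s k} → RE (Letter s k) → Lang (GS s k)
G (` inj₁ a) w = Σ _ λ β → rest w ≡ [ (a , β) ]
G (` inj₂ φ) w = rest w ≡ [] × first w ⊨ φ
G 𝟘 w = ⊥
G 𝟙 w = atoms w
G (e + f) w = G e w ⊎ G f w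
G (e · f) = G e ⋄ G f
G (e ⋆) w = Σ ℕ λ n → pow⋄ n (G e) w

{-# OPTIONS --safe #-}
-- A word over Σ + T_BA matches a guarded string α₀a₀α₁⋯αₙ when its actions are a₀…aₙ₋₁ and
-- each test between aᵢ₋₁ and aᵢ holds at αᵢ; G(e) is the set of guarded strings matched by
-- words of ⟦e⟧. Every hypothesis of H_kat preserves matching, so H_kat-closure never adds a
-- guarded string. Conversely, reading atoms as minterms, H_kat rewrites any word (in any
-- context) into the canonical words α₀a₀α₁⋯αₙ of the guarded strings it matches, and a
-- canonical word lies below every word matching its guarded string; so inclusion of the G's
-- lifts to inclusion of the closures.
module Submission where

open import Defs
open import Data.Nat using (ℕ)
open import Function.Bundles using (_⇔_; mk⇔)
open import Function using (id; _∘_)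
open import Data.Fin using (Fin; zero; suc)
open import Data.Bool as B using (Bool; true; false)
import Data.Bool.Properties as BP
open import Data.Vec using (Vec; lookup; []; _∷_)
open import Data.List using (List; []; _∷_; _++_; [_])
open import Data.List.Properties using (++-assoc; ++-identityʳ)
open import Data.Sum using (_⊎_; inj₁; inj₂)
open import Data.Product using (_×_; _,_; ∃-syntax)
open import Data.Empty using (⊥)
open import Relation.Binary.PropositionalEquality using (_≡_; refl; sym; trans; cong; cong₂; subst)

image : {A B : Set} → (A → B) → Lang A → Lang B
image f S y = ∃[ x ] S x × y ≡ f x

module Derivation {X : Set} (H : RE X → RE X → Set) where

  infix 4 _⊑_ _⊑₁_
  infixr 3 _⟫_

  -- w ⊑ S: every H-closure containing u S v contains u w v, i.e. w ≤ Σ S is derivable from H.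
  _⊑_ : List X → Lang (List X) → Set₁
  w ⊑ S = ∀ {L} (u v : List X) → (∀ x → S x → Clo H L (u ++ x ++ v)) → Clo H L (u ++ w ++ v)

  _⊑₁_ : List X → List X → Set₁
  w ⊑₁ y = w ⊑ (_≡ y)

  ∅ : Lang (List X)
  ∅ _ = ⊥

  ⊑-∈ : ∀ {w S} → S w → w ⊑ S
  ⊑-∈ sw u v k = k _ sw

  ⊑-trans : ∀ {w S T} → w ⊑ S → (∀ x → S x → x ⊑ T) → w ⊑ T
  ⊑-trans w⊑S S⊑T u v k = w⊑S u v (λ x sx → S⊑T x sx u v k)

  _⟫_ : ∀ {w y T} → w ⊑₁ y → y ⊑ T → w ⊑ T
  w⊑y ⟫ y⊑T = ⊑-trans w⊑y (λ { _ refl → y⊑T })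

  ⊑-mono : ∀ {w S T} → w ⊑ S → (∀ x → S x → T x) → w ⊑ T
  ⊑-mono w⊑S S⊆T = ⊑-trans w⊑S (λ x sx → ⊑-∈ (S⊆T x sx))

  ⊑-++ˡ : ∀ {w S} p → w ⊑ S → p ++ w ⊑ image (p ++_) S
  ⊑-++ˡ {w} p w⊑S {L} u v k =
    subst (Clo H L) (assoc w)
      (w⊑S (u ++ p) v (λ x sx → subst (Clo H L) (sym (assoc x)) (k _ (x , sx , refl))))
    where
    assoc : ∀ x → (u ++ p) ++ x ++ v ≡ u ++ (p ++ x) ++ v
    assoc x = trans (++-assoc u p (x ++ v)) (cong (u ++_) (sym (++-assoc p x v)))

  ⊑-++ʳ : ∀ {w S} q → w ⊑ S → w ++ q ⊑ image (_++ q) S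
  ⊑-++ʳ {w} q w⊑S {L} u v k =
    subst (Clo H L) (assoc w)
      (w⊑S u (q ++ v) (λ x sx → subst (Clo H L) (sym (assoc x)) (k _ (x , sx , refl))))
    where
    assoc : ∀ x → u ++ x ++ q ++ v ≡ u ++ (x ++ q) ++ v
    assoc x = cong (u ++_) (sym (++-assoc x q v))

  ⊑₁-++ˡ : ∀ {w y} p → w ⊑₁ y → p ++ w ⊑₁ p ++ y
  ⊑₁-++ˡ p w⊑y = ⊑-mono (⊑-++ˡ p w⊑y) λ { _ (_ , refl , refl) → refl }

  ⊑₁-++ʳ : ∀ {w y} q → w ⊑₁ y → w ++ q ⊑₁ y ++ q
  ⊑₁-++ʳ q w⊑y = ⊑-mono (⊑-++ʳ q w⊑y) λ { _ (_ , refl , refl) → refl }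

  ⊑₁-cong : ∀ {w y} p q → w ⊑₁ y → p ++ w ++ q ⊑₁ p ++ y ++ q
  ⊑₁-cong p q = ⊑₁-++ˡ p ∘ ⊑₁-++ʳ q

  ⊑∅-cong : ∀ {w T} p q → w ⊑ ∅ → p ++ w ++ q ⊑ T
  ⊑∅-cong p q w⊑∅ = ⊑-mono (⊑-++ˡ p (⊑-++ʳ q w⊑∅)) λ { _ (_ , (_ , () , _) , _) }

  ⊑-hyp : ∀ {e f w} → H e f → ⟦ e ⟧ w → w ⊑ ⟦ f ⟧
  ⊑-hyp e≤f ew u v k = hyp e≤f u v k _ ew refl

  ⊑-Clo : ∀ {L w S} → w ⊑ S → (∀ x → S x → Clo H L x) → Clo H L w
  ⊑-Clo {L} {w} w⊑S S⊆C = subst (Clo H L) (++-identityʳ w)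
    (w⊑S [] [] (λ x sx → subst (Clo H L) (sym (++-identityʳ x)) (S⊆C x sx)))

  Clo-bind : ∀ {L K} → (∀ w → L w → Clo H K w) → ∀ {w} → Clo H L w → Clo H K w
  Clo-bind L⊆C (base l) = L⊆C _ l
  Clo-bind L⊆C (hyp h u v k w ew eq) = hyp h u v (λ x fx → Clo-bind L⊆C (k x fx)) w ew eq

∧-≡true : ∀ x y → x B.∧ y ≡ true → x ≡ true × y ≡ true
∧-≡true true y eq = refl , eq

∨-≡true : ∀ x y → x B.∨ y ≡ true → x ≡ true ⊎ y ≡ true
∨-≡true true  y eq = inj₁ refl
∨-≡true false y eq = inj₂ eq

BAax-eval : ∀ {k} {φ ψ : BExp k} → BAax φ ψ → ∀ α → eval φ α ≡ eval ψ α
BAax-eval (∨-assoc φ ψ χ) α = BP.∨-assoc (eval φ α) _ _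
BAax-eval (∧-assoc φ ψ χ) α = BP.∧-assoc (eval φ α) _ _
BAax-eval (∨-comm φ ψ)    α = BP.∨-comm (eval φ α) _
BAax-eval (∧-comm φ ψ)    α = BP.∧-comm (eval φ α) _
BAax-eval (∨-absorb φ ψ)  α = BP.∨-abs-∧ (eval φ α) _
BAax-eval (∧-absorb φ ψ)  α = BP.∧-abs-∨ (eval φ α) _
BAax-eval (∨-idem φ)      α = BP.∨-idem (eval φ α)
BAax-eval (∧-idem φ)      α = BP.∧-idem (eval φ α)
BAax-eval (∧-distr φ ψ χ) α = BP.∧-distribˡ-∨ (eval φ α) _ _
BAax-eval (∨-distr φ ψ χ) α = BP.∨-distribˡ-∧ (eval φ α) _ _
BAax-eval (∨-bot φ)       α = BP.∨-identityʳ (eval φ α)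
BAax-eval (∧-top φ)       α = BP.∧-identityʳ (eval φ α)
BAax-eval (∨-compl φ)     α = BP.∨-inverseʳ (eval φ α)
BAax-eval (∧-compl φ)     α = BP.∧-inverseʳ (eval φ α)

module KAT {s k : ℕ} where

  open Derivation (Hkat {s} {k})

  Word : Set
  Word = List (Letter s k)

  test : BExp k → Letter s k
  test = inj₂

  ∧-split : ∀ {φ ψ} → [ test (φ ⋀ ψ) ] ⊑₁ test φ ∷ test ψ ∷ []
  ∧-split {φ} {ψ} = ⊑-mono (⊑-hyp (∧·≤ φ ψ) refl) λ { _ (_ , _ , refl , refl , refl) → refl }

  ∧-join : ∀ {φ ψ} → test φ ∷ test ψ ∷ [] ⊑₁ [ test (φ ⋀ ψ) ]
  ∧-join {φ} {ψ} = ⊑-hyp (∧·≥ φ ψ) (_ , _ , refl , refl , refl)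

  ∨-split : ∀ {φ ψ} → [ test (φ ⋁ ψ) ] ⊑ (λ y → y ≡ [ test φ ] ⊎ y ≡ [ test ψ ])
  ∨-split {φ} {ψ} = ⊑-hyp (∨+≤ φ ψ) refl

  ∨-introˡ : ∀ {φ ψ} → [ test φ ] ⊑₁ [ test (φ ⋁ ψ) ]
  ∨-introˡ {φ} {ψ} = ⊑-hyp (∨+≥ φ ψ) (inj₁ refl)

  ∨-introʳ : ∀ {φ ψ} → [ test ψ ] ⊑₁ [ test (φ ⋁ ψ) ]
  ∨-introʳ {φ} {ψ} = ⊑-hyp (∨+≥ φ ψ) (inj₂ refl)

  bot-elim : [ test bot ] ⊑ ∅
  bot-elim = ⊑-hyp bot≤ refl

  top-intro : [] ⊑₁ [ test top ]
  top-intro = ⊑-hyp top≥ refl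

  top-elim : [ test top ] ⊑₁ []
  top-elim = ⊑-hyp top≤ refl

  BAax⇒⊑ : ∀ {φ ψ} → BAax φ ψ → [ test φ ] ⊑₁ [ test ψ ]
  BAax⇒⊑ ax = ⊑-hyp (bool≤ ax) refl

  BAax⇒⊒ : ∀ {φ ψ} → BAax φ ψ → [ test ψ ] ⊑₁ [ test φ ]
  BAax⇒⊒ ax = ⊑-hyp (bool≥ ax) refl

  test-drop : ∀ φ → [ test φ ] ⊑₁ []
  test-drop φ = ∨-introˡ {φ} { ! φ} ⟫ BAax⇒⊑ (∨-compl φ) ⟫ top-elim

  test-dup : ∀ φ → [ test φ ] ⊑₁ test φ ∷ test φ ∷ []
  test-dup φ = BAax⇒⊒ (∧-idem φ) ⟫ ∧-split

  test-contra : ∀ φ → test φ ∷ test (! φ) ∷ [] ⊑ ∅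
  test-contra φ = ∧-join ⟫ BAax⇒⊑ (∧-compl φ) ⟫ bot-elim

  !test-contra : ∀ φ → test (! φ) ∷ test φ ∷ [] ⊑ ∅
  !test-contra φ = ∧-join ⟫ BAax⇒⊑ (∧-comm (! φ) φ) ⟫ BAax⇒⊑ (∧-compl φ) ⟫ bot-elim

  excluded-middle : ∀ φ → [] ⊑ (λ y → y ≡ [ test φ ] ⊎ y ≡ [ test (! φ) ])
  excluded-middle φ = top-intro ⟫ BAax⇒⊒ (∨-compl φ) ⟫ ∨-split

  literal : Bool → BExp k → BExp k
  literal true  φ = φ
  literal false φ = ! φ

  minterm : ∀ {n} → Vec Bool n → (Fin n → Fin k) → BExp k
  minterm []       ι = top
  minterm (c ∷ cs) ι = literal c (var (ι zero)) ⋀ minterm cs (ι ∘ suc)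

  atom : At k → BExp k
  atom α = minterm α id

  minterm-⊑-literal : ∀ {n} (cs : Vec Bool n) ι i →
                      [ test (minterm cs ι) ] ⊑₁ [ test (literal (lookup cs i) (var (ι i))) ]
  minterm-⊑-literal (c ∷ cs) ι zero    = ∧-split ⟫ ⊑₁-cong [ _ ] [] (test-drop _)
  minterm-⊑-literal (c ∷ cs) ι (suc i) =
    ∧-split ⟫ ⊑₁-cong [] [ _ ] (test-drop _) ⟫ minterm-⊑-literal cs (ι ∘ suc) i

  minterm-cover : ∀ {n} (ι : Fin n → Fin k) → [] ⊑ (λ y → ∃[ cs ] y ≡ [ test (minterm cs ι) ])
  minterm-cover {ℕ.zero}  ι = top-intro ⟫ ⊑-∈ ([] , refl)
  minterm-cover {ℕ.suc n} ι = ⊑-trans (minterm-cover (ι ∘ suc)) λ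
    { _ (cs , refl) → ⊑-trans (⊑-++ʳ [ test (minterm cs (ι ∘ suc)) ] (excluded-middle (var (ι zero)))) λ
      { _ (_ , inj₁ refl , refl) → ∧-join ⟫ ⊑-∈ (true ∷ cs , refl)
      ; _ (_ , inj₂ refl , refl) → ∧-join ⟫ ⊑-∈ (false ∷ cs , refl) } }

  ⊑-atom-prefix : ∀ w → w ⊑ (λ y → ∃[ α ] y ≡ test (atom α) ∷ w)
  ⊑-atom-prefix w = ⊑-mono (⊑-++ʳ w (minterm-cover id)) λ { _ (_ , (α , refl) , refl) → α , refl }

  atom-⊑-literal : ∀ α o {c} → lookup α o ≡ c → [ test (atom α) ] ⊑₁ [ test (literal c (var o)) ]
  atom-⊑-literal α o refl = minterm-⊑-literal α id o

  atom-⊑-sat   : ∀ φ α → eval φ α ≡ true → [ test (atom α) ] ⊑₁ [ test φ ]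
  atom-⊑-unsat : ∀ φ α → eval φ α ≡ false → test (atom α) ∷ test φ ∷ [] ⊑ ∅

  atom-⊑-sat (φ ⋁ ψ) α αφ∨ψ with ∨-≡true (eval φ α) _ αφ∨ψ
  ... | inj₁ αφ = atom-⊑-sat φ α αφ ⟫ ∨-introˡ
  ... | inj₂ αψ = atom-⊑-sat ψ α αψ ⟫ ∨-introʳ
  atom-⊑-sat (φ ⋀ ψ) α αφ∧ψ with ∧-≡true (eval φ α) _ αφ∧ψ
  ... | αφ , αψ = test-dup _ ⟫ ⊑₁-cong [] [ test (atom α) ] (atom-⊑-sat φ α αφ)
                             ⟫ ⊑₁-cong [ test φ ] [] (atom-⊑-sat ψ α αψ) ⟫ ∧-join
  atom-⊑-sat (! φ) α _ with eval φ α in α⊭φ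
  ... | false = ⊑-trans (⊑-++ˡ [ test (atom α) ] (excluded-middle φ)) λ
    { _ (_ , inj₁ refl , refl) → ⊑-mono (atom-⊑-unsat φ α α⊭φ) λ _ ()
    ; _ (_ , inj₂ refl , refl) → ⊑₁-cong [] [ test (! φ) ] (test-drop (atom α)) }
  atom-⊑-sat top     α _   = test-drop _ ⟫ top-intro
  atom-⊑-sat (var o) α αo  = atom-⊑-literal α o αo

  atom-⊑-unsat (φ ⋁ ψ) α _ with eval φ α in α⊭φ | eval ψ α in α⊭ψ
  ... | false | false = ⊑-trans (⊑-++ˡ [ test (atom α) ] ∨-split) λ
    { _ (_ , inj₁ refl , refl) → atom-⊑-unsat φ α α⊭φ
    ; _ (_ , inj₂ refl , refl) → atom-⊑-unsat ψ α α⊭ψ }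
  atom-⊑-unsat (φ ⋀ ψ) α α⊭φ∧ψ with eval φ α in evalφ
  ... | false = ⊑₁-cong [ test (atom α) ] [] ∧-split ⟫ ⊑∅-cong [] [ test ψ ] (atom-⊑-unsat φ α evalφ)
  ... | true  = ⊑₁-cong [ test (atom α) ] [] ∧-split ⟫ ⊑₁-cong [ test (atom α) ] [ test ψ ] (test-drop φ)
                ⟫ atom-⊑-unsat ψ α α⊭φ∧ψ
  atom-⊑-unsat (! φ) α _ with eval φ α in α⊨φ
  ... | true = ⊑₁-cong [] [ test (! φ) ] (atom-⊑-sat φ α α⊨φ) ⟫ test-contra φ
  atom-⊑-unsat bot     α _   = ⊑∅-cong [ test (atom α) ] [] bot-elim
  atom-⊑-unsat (var o) α α⊭o = ⊑₁-cong [] [ test (var o) ] (atom-⊑-literal α o α⊭o) ⟫ !test-contra (var o)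

  Matches : Word → At k → List (Fin s × At k) → Set
  Matches []           α xs             = xs ≡ []
  Matches (inj₂ φ ∷ w) α xs             = α ⊨ φ × Matches w α xs
  Matches (inj₁ a ∷ w) α []             = ⊥
  Matches (inj₁ a ∷ w) α ((b , β) ∷ xs) = a ≡ b × Matches w β xs

  Matches-++ : ∀ u {v α xs ys} → Matches u α xs → Matches v (lastAt α xs) ys →
               Matches (u ++ v) α (xs ++ ys)
  Matches-++ []           refl     mv = mv
  Matches-++ (inj₂ φ ∷ u) (αφ , mu) mv = αφ , Matches-++ u mu mv
  Matches-++ (inj₁ a ∷ u) {xs = _ ∷ _} (refl , mu) mv = refl , Matches-++ u mu mv

  Matches-++⁻ : ∀ u {v α zs} → Matches (u ++ v) α zs →
                ∃[ xs ] ∃[ ys ] zs ≡ xs ++ ys × Matches u α xs × Matches v (lastAt α xs) ys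
  Matches-++⁻ [] m = [] , _ , refl , refl , m
  Matches-++⁻ (inj₂ φ ∷ u) (αφ , m) with Matches-++⁻ u m
  ... | xs , ys , eq , mu , mv = xs , ys , eq , (αφ , mu) , mv
  Matches-++⁻ (inj₁ a ∷ u) {zs = (_ , β) ∷ _} (refl , m) with Matches-++⁻ u m
  ... | xs , ys , eq , mu , mv = (a , β) ∷ xs , ys , cong ((a , β) ∷_) eq , (refl , mu) , mv

  powL⇒pow⋄ : ∀ e → (∀ {w α xs} → ⟦ e ⟧ w → Matches w α xs → G e (gs α xs)) →
              ∀ n {w α xs} → powL n ⟦ e ⟧ w → Matches w α xs → pow⋄ n (G e) (gs α xs)
  powL⇒pow⋄ e ⟦e⟧⇒G ℕ.zero    refl m = m
  powL⇒pow⋄ e ⟦e⟧⇒G (ℕ.suc n) (u , v , refl , eu , ev) m with Matches-++⁻ u m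
  ... | xs , ys , refl , mu , mv =
    gs _ xs , gs _ ys , ⟦e⟧⇒G eu mu , powL⇒pow⋄ e ⟦e⟧⇒G n ev mv , refl , refl

  ⟦⟧⇒G : ∀ e {w α xs} → ⟦ e ⟧ w → Matches w α xs → G e (gs α xs)
  ⟦⟧⇒G (e + f) (inj₁ ew) m = inj₁ (⟦⟧⇒G e ew m)
  ⟦⟧⇒G (e + f) (inj₂ fw) m = inj₂ (⟦⟧⇒G f fw m)
  ⟦⟧⇒G (e · f) (u , v , refl , eu , fv) m with Matches-++⁻ u m
  ... | xs , ys , refl , mu , mv = gs _ xs , gs _ ys , ⟦⟧⇒G e eu mu , ⟦⟧⇒G f fv mv , refl , refl
  ⟦⟧⇒G (e ⋆) (n , ew) m = n , powL⇒pow⋄ e (⟦⟧⇒G e) n ew m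
  ⟦⟧⇒G 𝟙 refl m = m
  ⟦⟧⇒G (` inj₁ a) {xs = (_ , β) ∷ _} refl (refl , refl) = β , refl
  ⟦⟧⇒G (` inj₂ φ) refl (αφ , m) = m , αφ

  pow⋄⇒powL : ∀ e → (∀ {g} → G e g → ∃[ w ] ⟦ e ⟧ w × Matches w (first g) (rest g)) →
              ∀ n {g} → pow⋄ n (G e) g → ∃[ w ] powL n ⟦ e ⟧ w × Matches w (first g) (rest g)
  pow⋄⇒powL e G⇒⟦e⟧ ℕ.zero {gs α []} refl = [] , refl , refl
  pow⋄⇒powL e G⇒⟦e⟧ (ℕ.suc n) (_ , _ , gx , gy , refl , refl)
    with G⇒⟦e⟧ gx | pow⋄⇒powL e G⇒⟦e⟧ n gy
  ... | u , eu , mu | v , ev , mv = u ++ v , (u , v , refl , eu , ev) , Matches-++ u mu mv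

  G⇒⟦⟧ : ∀ e {g} → G e g → ∃[ w ] ⟦ e ⟧ w × Matches w (first g) (rest g)
  G⇒⟦⟧ (e + f) (inj₁ ge) with G⇒⟦⟧ e ge
  ... | w , ew , m = w , inj₁ ew , m
  G⇒⟦⟧ (e + f) (inj₂ gf) with G⇒⟦⟧ f gf
  ... | w , fw , m = w , inj₂ fw , m
  G⇒⟦⟧ (e · f) (_ , _ , ge , gf , refl , refl) with G⇒⟦⟧ e ge | G⇒⟦⟧ f gf
  ... | u , eu , mu | v , fv , mv = u ++ v , (u , v , refl , eu , fv) , Matches-++ u mu mv
  G⇒⟦⟧ (e ⋆) (n , ge) with pow⋄⇒powL e (G⇒⟦⟧ e) n ge
  ... | w , ew , m = w , (n , ew) , m
  G⇒⟦⟧ 𝟙 {gs α []} refl = [] , refl , refl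
  G⇒⟦⟧ (` inj₁ a) {gs α ((a , β) ∷ [])} (β , refl) = [ inj₁ a ] , refl , refl , refl
  G⇒⟦⟧ (` inj₂ φ) {gs α []} (refl , αφ) = [ inj₂ φ ] , refl , αφ , refl

  Hkat-preserves-Matches : ∀ {e f w α xs} → Hkat e f → ⟦ e ⟧ w → Matches w α xs →
                           ∃[ w′ ] ⟦ f ⟧ w′ × Matches w′ α xs
  Hkat-preserves-Matches {α = α} (bool≤ ax) refl (αφ , m) = _ , refl , trans (sym (BAax-eval ax α)) αφ , m
  Hkat-preserves-Matches {α = α} (bool≥ ax) refl (αψ , m) = _ , refl , trans (BAax-eval ax α) αψ , m
  Hkat-preserves-Matches {α = α} (∧·≤ φ ψ) refl (αφ∧ψ , m) with ∧-≡true (eval φ α) _ αφ∧ψ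
  ... | αφ , αψ = _ , (_ , _ , refl , refl , refl) , αφ , αψ , m
  Hkat-preserves-Matches (∧·≥ φ ψ) (_ , _ , refl , refl , refl) (αφ , αψ , m) =
    _ , refl , cong₂ B._∧_ αφ αψ , m
  Hkat-preserves-Matches {α = α} (∨+≤ φ ψ) refl (αφ∨ψ , m) with ∨-≡true (eval φ α) _ αφ∨ψ
  ... | inj₁ αφ = _ , inj₁ refl , αφ , m
  ... | inj₂ αψ = _ , inj₂ refl , αψ , m
  Hkat-preserves-Matches (∨+≥ φ ψ) (inj₁ refl) (αφ , m) = _ , refl , cong (B._∨ _) αφ , m
  Hkat-preserves-Matches {α = α} (∨+≥ φ ψ) (inj₂ refl) (αψ , m) =
    _ , refl , trans (BP.∨-comm (eval φ α) _) (cong (B._∨ _) αψ) , m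
  Hkat-preserves-Matches bot≤ refl (() , _)
  Hkat-preserves-Matches top≤ refl (_ , m) = [] , refl , m
  Hkat-preserves-Matches top≥ refl m = _ , refl , refl , m

  Clo-sound : ∀ {f w} → Clo Hkat ⟦ f ⟧ w → ∀ {α xs} → Matches w α xs → G f (gs α xs)
  Clo-sound {f} (base fw) m = ⟦⟧⇒G f fw m
  Clo-sound (hyp e≤f u v k w ew refl) m with Matches-++⁻ u m
  ... | xs₁ , _ , refl , mu , mwv with Matches-++⁻ w mwv
  ... | xs₂ , _ , refl , mw , mv with Hkat-preserves-Matches e≤f ew mw
  ... | w′ , fw′ , mw′ = Clo-sound (k w′ fw′) (Matches-++ u mu (Matches-++ w′ mw′ mv))

  canonicalRest : List (Fin s × At k) → Word
  canonicalRest []             = []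
  canonicalRest ((a , β) ∷ xs) = inj₁ a ∷ test (atom β) ∷ canonicalRest xs

  canonical : At k → List (Fin s × At k) → Word
  canonical α xs = test (atom α) ∷ canonicalRest xs

  canonical-⊑ : ∀ w {α xs} → Matches w α xs → canonical α xs ⊑₁ w
  canonical-⊑ [] refl = test-drop _
  canonical-⊑ (inj₂ φ ∷ w) {α} {xs} (αφ , m) =
    ⊑₁-cong [] (canonicalRest xs) (test-dup (atom α))
    ⟫ ⊑₁-cong [] (canonical α xs) (atom-⊑-sat φ α αφ)
    ⟫ ⊑₁-++ˡ [ test φ ] (canonical-⊑ w m)
  canonical-⊑ (inj₁ a ∷ w) {α} {(_ , β) ∷ xs} (refl , m) =
    ⊑₁-cong [] (inj₁ a ∷ canonical β xs) (test-drop (atom α)) ⟫ ⊑₁-++ˡ [ inj₁ a ] (canonical-⊑ w m)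

  atom-prefix-⊑-canonical : ∀ w α →
    test (atom α) ∷ w ⊑ (λ y → ∃[ xs ] Matches w α xs × y ≡ canonical α xs)
  atom-prefix-⊑-canonical [] α = ⊑-∈ ([] , refl , refl)
  atom-prefix-⊑-canonical (inj₂ φ ∷ w) α with eval φ α in evalφ
  ... | true  = ⊑₁-cong [ test (atom α) ] w (test-drop φ)
                ⟫ ⊑-mono (atom-prefix-⊑-canonical w α) λ { _ (xs , m , refl) → xs , (refl , m) , refl }
  ... | false = ⊑∅-cong [] w (atom-⊑-unsat φ α evalφ)
  atom-prefix-⊑-canonical (inj₁ a ∷ w) α =
    ⊑-trans (⊑-++ˡ (test (atom α) ∷ inj₁ a ∷ []) (⊑-atom-prefix w)) λ
      { _ (_ , (β , refl) , refl) →
          ⊑-mono (⊑-++ˡ (test (atom α) ∷ inj₁ a ∷ []) (atom-prefix-⊑-canonical w β))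
            λ { _ (_ , (xs , m , refl) , refl) → (a , β) ∷ xs , (refl , m) , refl } }

  ⊑-canonical : ∀ w → w ⊑ (λ y → ∃[ α ] ∃[ xs ] Matches w α xs × y ≡ canonical α xs)
  ⊑-canonical w = ⊑-trans (⊑-atom-prefix w) λ
    { _ (α , refl) → ⊑-mono (atom-prefix-⊑-canonical w α) λ { _ (xs , m , eq) → α , xs , m , eq } }

  G⊆⇒Clo⊆ : ∀ e f → (∀ g → G e g → G f g) → ∀ w → Clo Hkat ⟦ e ⟧ w → Clo Hkat ⟦ f ⟧ w
  G⊆⇒Clo⊆ e f Ge⊆Gf _ = Clo-bind λ w ew → ⊑-Clo (⊑-canonical w)
    λ { _ (α , xs , m , refl) → canonical⊆Clo (G⇒⟦⟧ f (Ge⊆Gf _ (⟦⟧⇒G e ew m))) }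
    where
    canonical⊆Clo : ∀ {α xs} → ∃[ w′ ] ⟦ f ⟧ w′ × Matches w′ α xs → Clo Hkat ⟦ f ⟧ (canonical α xs)
    canonical⊆Clo (w′ , fw′ , m′) = ⊑-Clo (canonical-⊑ w′ m′) λ { _ refl → base fw′ }

  Clo⊆⇒G⊆ : ∀ e f → (∀ w → Clo Hkat ⟦ e ⟧ w → Clo Hkat ⟦ f ⟧ w) → ∀ g → G e g → G f g
  Clo⊆⇒G⊆ e f Clo⊆ g ge with G⇒⟦⟧ e ge
  ... | w , ew , m = Clo-sound (Clo⊆ w (base ew)) m

open KAT

corollary4p6 : (s k : ℕ) (e f : RE (Letter s k)) →
               (G e ≐ G f) ⇔ (Clo Hkat ⟦ e ⟧ ≐ Clo Hkat ⟦ f ⟧)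
corollary4p6 s k e f = mk⇔
  (λ { (Ge⊆Gf , Gf⊆Ge) → G⊆⇒Clo⊆ e f Ge⊆Gf , G⊆⇒Clo⊆ f e Gf⊆Ge })
  (λ { (Ce⊆Cf , Cf⊆Ce) → Clo⊆⇒G⊆ e f Ce⊆Cf , Clo⊆⇒G⊆ f e Cf⊆Ce })
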